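{- In the decomposition of any path in $\Gamma_5$ into conveyor belts, ladders and chutes, every ladder subpath (that is followed by a further subpath) is followed by a conveyor belt, and every chute subpath (that is preceded by a further subpath) is preceded by a conveyor belt.
   Context: Define sets of positive integers $R_1,R_2,\dots$ recursively: $R_1=\{2\}$; if $x\in R_k$ then $(x+5)^2\in R_{k+1}$; if $x^2\in R_k$ then $x\in R_{k+1}$. Let $S=\bigcup_i R_i$. The directed graph $\Gamma_5$ has vertex set $S$, up-edges $U$: $(n,(n+5)^2)$ for $n\in S$, and down-edges $D$: $(n^2,n)$ for $n\in S$. A path is a directed walk, recorded as a word in $U,D$. A conveyor belt is a subpath of the form $(UD)^i$, $i\ge1$; a ladder is a subpath $U^i$, $i\ge1$; a chute is a subpath $D^i$, $i\ge 1$. Every path decomposes as follows: its maximal subpaths of the form $(UD)^i$ are its conveyor belts; each remaining maximal segment contains no $UD$ and so is of the form $U^i$ (a ladder), $D^i$ (a chute), or $D^nU^m$ (a chute followed by a ladder). -}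

module Defs where

open import Data.Nat using (ℕ; zero; suc; _+_; _*_; _≤_; _<_)
open import Data.List using (List; []; _∷_; length)
open import Data.Maybe using (Maybe; just; nothing)
open import Data.Product using (Σ; ∃; _×_; _,_)
open import Data.Sum using (_⊎_)
open import Relation.Binary.PropositionalEquality using (_≡_)
open import Relation.Nullary using (¬_)

-- The sets R_k (R k x  means  x ∈ R_k) and S = ⋃ R_k

data R : ℕ → ℕ → Set where
  base : R 1 2
  up   : ∀ {k x} → R k x → R (suc k) ((x + 5) * (x + 5))
  down : ∀ {k x} → R k (x * x) → R (suc k) x

S : ℕ → Set
S n = ∃ λ k → R k n

-- Paths (directed walks) in Γ₅, recorded with their word in U, D.
-- Path v w : there is a directed walk in Γ₅ starting at vertex v whose
-- sequence of edge labels is w.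

data Move : Set where
  U D : Move

data Path : ℕ → List Move → Set where
  stop  : ∀ {v} → S v → Path v []
  stepU : ∀ {n m w} → S n → m ≡ (n + 5) * (n + 5) → Path m w → Path n (U ∷ w)
  -- down-edge (n^2 , n), both endpoints in S (n^2 ∈ S implies n ∈ S)
  stepD : ∀ {m n w} → S m → m ≡ n * n → Path n w → Path m (D ∷ w)

-- Positions in a word (0-based); the subpath [i , j) consists of the
-- edges at positions i, …, j-1.

at : List Move → ℕ → Maybe Move
at []      _       = nothing
at (x ∷ _) zero    = just x
at (_ ∷ w) (suc p) = at w p

UDForm : List Move → ℕ → ℕ → Set
UDForm w i k = ∀ t → t < k → (at w (i + 2 * t) ≡ just U) × (at w (suc (i + 2 * t)) ≡ just D)

UDSubpath : List Move → ℕ → ℕ → Set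
UDSubpath w i j = Σ ℕ λ k → (1 ≤ k) × (j ≡ i + 2 * k) × UDForm w i k

ConveyorBelt : List Move → ℕ → ℕ → Set
ConveyorBelt w i j =
  UDSubpath w i j ×
  (∀ i' j' → UDSubpath w i' j' → i' ≤ i → j ≤ j' → (i' ≡ i) × (j' ≡ j))

InBelt : List Move → ℕ → Set
InBelt w p = Σ ℕ λ i → Σ ℕ λ j → ConveyorBelt w i j × (i ≤ p) × (p < j)

Remaining : List Move → ℕ → ℕ → Set
Remaining w i j =
  (i < j) × (j ≤ length w) ×
  (∀ p → i ≤ p → p < j → ¬ InBelt w p) ×
  ((i ≡ 0) ⊎ (Σ ℕ λ i' → (i ≡ suc i') × InBelt w i')) ×
  ((j ≡ length w) ⊎ InBelt w j)

-- [a , j) is a ladder of the decomposition: the (maximal) U^m part of a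
-- remaining segment [i , j)  (which has the form U^m, or D^n U^m)
Ladder : List Move → ℕ → ℕ → Set
Ladder w a j = Σ ℕ λ i →
  Remaining w i j × (i ≤ a) × (a < j) ×
  (∀ p → a ≤ p → p < j → at w p ≡ just U) ×
  ((a ≡ i) ⊎ (Σ ℕ λ a' → (a ≡ suc a') × (at w a' ≡ just D)))

-- [i , b) is a chute of the decomposition: the (maximal) D^n part of a
-- remaining segment [i , j)  (which has the form D^n, or D^n U^m)
Chute : List Move → ℕ → ℕ → Set
Chute w i b = Σ ℕ λ j →
  Remaining w i j × (i < b) × (b ≤ j) ×
  (∀ p → i ≤ p → p < b → at w p ≡ just D) ×
  ((b ≡ j) ⊎ (at w b ≡ just U))

module Submission where

open import Defs
open import Data.Nat using (ℕ; zero; suc; _<_; _≤_; _≤?_)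
open import Data.Nat.Properties using (≤-refl; ≤-trans; ≤-antisym; ≤-pred; n≤1+n; <-irrefl; ≰⇒>)
open import Data.List using (List; length)
open import Data.Product using (Σ; _×_; _,_)
open import Data.Sum using (inj₁; inj₂)
open import Data.Empty using (⊥-elim)
open import Relation.Nullary using (¬_; yes; no)
open import Relation.Binary.PropositionalEquality using (refl; subst)

-- The remaining segments are exactly the gaps between consecutive conveyor
-- belts, so each one is bordered by a belt on every side that is not an end
-- of the word.  This is pure combinatorics of words: no property of Γ₅ is used.

inBelt-after-gap : ∀ w {p} → ¬ InBelt w p → InBelt w (suc p) →
                   Σ ℕ λ k → ConveyorBelt w (suc p) k
inBelt-after-gap w {p} p∉belt (i , j , belt , i≤1+p , 1+p<j) with i ≤? p
... | yes i≤p = ⊥-elim (p∉belt (i , j , belt , i≤p , ≤-trans (n≤1+n _) 1+p<j))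
... | no  i≰p with ≤-antisym i≤1+p (≰⇒> i≰p)
...   | refl = j , belt

inBelt-before-gap : ∀ w {p} → InBelt w p → ¬ InBelt w (suc p) →
                    Σ ℕ λ k → ConveyorBelt w k (suc p)
inBelt-before-gap w {p} (i , j , belt , i≤p , p<j) 1+p∉belt with j ≤? suc p
... | yes j≤1+p = i , subst (ConveyorBelt w i) (≤-antisym j≤1+p p<j) belt
... | no  j≰1+p = ⊥-elim (1+p∉belt (i , j , belt , ≤-trans i≤p (n≤1+n p) , ≰⇒> j≰1+p))

remaining-followedBy-belt : ∀ w {i j} → Remaining w i j → j < length w →
                            Σ ℕ λ k → ConveyorBelt w j k
remaining-followedBy-belt w {j = zero} (() , _)
remaining-followedBy-belt w {j = suc j} (_ , _ , _ , _ , inj₁ end) j<len =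
  ⊥-elim (<-irrefl end j<len)
remaining-followedBy-belt w {j = suc j} (i<1+j , _ , outside , _ , inj₂ 1+j∈belt) _ =
  inBelt-after-gap w (outside j (≤-pred i<1+j) ≤-refl) 1+j∈belt

remaining-precededBy-belt : ∀ w {i j} → Remaining w i j → 0 < i →
                            Σ ℕ λ k → ConveyorBelt w k i
remaining-precededBy-belt w (_ , _ , _ , inj₁ refl , _) ()
remaining-precededBy-belt w (i<j , _ , outside , inj₂ (p , refl , p∈belt) , _) _ =
  inBelt-before-gap w p∈belt (outside _ ≤-refl i<j)

corollary8 : ∀ {v : ℕ} {w : List Move} → Path v w →
    (∀ a j → Ladder w a j → j < length w → Σ ℕ λ k → ConveyorBelt w j k) ×
    (∀ i b → Chute w i b → 0 < i → Σ ℕ λ k → ConveyorBelt w k i)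
corollary8 {w = w} _ =
  (λ { _ _ (_ , segment , _) → remaining-followedBy-belt w segment }) ,
  (λ { _ _ (_ , segment , _) → remaining-precededBy-belt w segment })
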